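{- Let $G$ be a labeled graph, $v$ a node of minimal positive label, and let $H_1,\dots,H_k$ be an enumeration of all standard components of $G$ that give $v$ the label $1$, with $H_1$ the maximal standard component of $G$. Let $\mathcal H$ be a finite multiset whose elements are among $H_1,\dots,H_k$, and set $F=G\ominus\sum\mathcal H$. Then for every $1\le i\le k$: there exists a standard $v$-decomposition of $F$ all of whose elements belong to $\{H_1,\dots,H_i\}$ if and only if $F$ is standard.
   Context: A labeled graph: finite node set, directed edges without loops, integer labeling $\ell$. It is standard if labels are $\ge0$ and $\ell(a)\le\ell(b)$ for each edge $(a,b)$. For graphs with the same nodes and edges, $\oplus,\ominus$ add/subtract labels nodewise; $\sum$ denotes sum of a multiset. A standard component of a labeled graph $F$ is a labeled graph $H$ with the same nodes and edges, labels in $\{0,1\}$, $H$ standard, $F\ominus H$ standard, not all labels of $H$ zero. The maximal standard component of $G$ has label $1$ exactly at nodes where $\ell_G>0$. A standard $v$-decomposition of $F$ is a finite multiset $\mathcal K$ of standard components of $F$ each giving $v$ label $1$, with $F\ominus\sum\mathcal K$ standard and $|\mathcal K|=\ell_F(v)$. -}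

module Defs where

open import Data.Nat using (ℕ)
open import Data.Integer using (ℤ; _+_; _-_; _≤_; _<_; +_)
open import Data.Integer.Properties using () renaming (_<?_ to _<ℤ?_)
open import Data.Fin using (Fin)
open import Data.Vec using (Vec; lookup; zipWith; replicate; tabulate)
open import Data.List using (List; []; _∷_; foldr; length)
open import Data.List.Membership.Propositional using (_∈_)
open import Data.Product using (_×_; _,_; proj₁; proj₂; ∃)
open import Data.Sum using (_⊎_)
open import Relation.Binary.PropositionalEquality using (_≡_; _≢_)
open import Relation.Nullary using (yes; no)
open import Data.List.Relation.Unary.All using (All)

-- A labeled graph has node set Fin n, a finite edge list E (directed edges),
-- and a labeling ℓ : Vec ℤ n (label of node a is lookup ℓ a).
-- Graphs with the same nodes and edges are compared/combined through their labelings.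

Edges : ℕ → Set
Edges n = List (Fin n × Fin n)

NoLoops : ∀ {n} → Edges n → Set
NoLoops E = All (λ e → proj₁ e ≢ proj₂ e) E

Labeling : ℕ → Set
Labeling n = Vec ℤ n

Standard : ∀ {n} → Edges n → Labeling n → Set
Standard {n} E ℓ =
  (∀ (a : Fin n) → + 0 ≤ lookup ℓ a) ×
  (∀ (a b : Fin n) → (a , b) ∈ E → lookup ℓ a ≤ lookup ℓ b)

_⊕_ : ∀ {n} → Labeling n → Labeling n → Labeling n
_⊕_ = zipWith _+_

_⊖_ : ∀ {n} → Labeling n → Labeling n → Labeling n
_⊖_ = zipWith _-_

zeroL : ∀ {n} → Labeling n
zeroL = replicate _ (+ 0)

-- sum of a finite multiset (given as a list)
∑ : ∀ {n} → List (Labeling n) → Labeling n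
∑ = foldr _⊕_ zeroL

StandardComponent : ∀ {n} → Edges n → Labeling n → Labeling n → Set
StandardComponent {n} E F H =
  (∀ (a : Fin n) → lookup H a ≡ + 0 ⊎ lookup H a ≡ + 1) ×
  Standard E H ×
  Standard E (F ⊖ H) ×
  ∃ (λ (a : Fin n) → lookup H a ≢ + 0)

maximalComponent : ∀ {n} → Labeling n → Labeling n
maximalComponent G = tabulate (λ a → f (lookup G a))
  where
  f : ℤ → ℤ
  f x with + 0 <ℤ? x
  ... | yes _ = + 1
  ... | no _  = + 0

StandardVDecomposition : ∀ {n} → Edges n → Labeling n → Fin n → List (Labeling n) → Set
StandardVDecomposition E F v K =
  All (λ H → StandardComponent E F H × lookup H v ≡ + 1) K ×
  Standard E (F ⊖ ∑ K) ×
  + (length K) ≡ lookup F v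

MinimalPositive : ∀ {n} → Labeling n → Fin n → Set
MinimalPositive {n} G v =
  + 0 < lookup G v × (∀ (u : Fin n) → + 0 < lookup G u → lookup G v ≤ lookup G u)

module Submission where

-- Proof idea.  Write F = G ⊖ ∑ℋ and M for the maximal standard component of G.
--
-- (⇒) If K is a standard v-decomposition of F, then F = (F ⊖ ∑K) ⊕ ∑K is a sum
--     of standard labelings, and standard labelings are closed under ⊕.
-- (⇐) If F is standard, take K = d copies of M, where d = ℓ_F(v).  Every element
--     of ℋ is a 0/1 labeling below G with value 1 at v, so ∑ℋ vanishes where G
--     does and is at most |ℋ| = (∑ℋ)(v) everywhere.  Since v has minimal positive
--     label, F vanishes off the support of M and is ≥ d on it.  "Peeling" e ≤ d
--     copies of M off such an F keeps it standard; with e = 1 this shows M is a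
--     standard component of F, with e = d that F ⊖ ∑K is standard.  As M = H₁,
--     K only uses H₁, …, Hᵢ for every i ≥ 1.

open import Defs
open import Data.Nat using (ℕ; _≤_; zero; suc; s≤s; z≤n)
open import Data.Integer using (ℤ; +_; _+_; _-_; -_; ∣_∣)
  renaming (_≤_ to _≤ℤ_; _<_ to _<ℤ_)
open import Data.Integer.Base using (+≤+; +<+)
import Data.Integer.Properties as ℤP
import Data.Nat.Properties as ℕP
open import Data.Fin using (Fin)
import Data.Fin as Fin
open import Data.Vec using (lookup)
import Data.Vec as Vec
open import Data.Vec.Properties
  using (lookup-zipWith; lookup-replicate; tabulate∘lookup; tabulate-cong)
open import Data.List using (List; []; _∷_; length; take; replicate)
open import Data.List.Properties using (length-replicate)
open import Data.List.Membership.Propositional using (_∈_)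
open import Data.List.Relation.Unary.All using (All; []; _∷_)
import Data.List.Relation.Unary.All as All
open import Data.List.Relation.Unary.All.Properties using (replicate⁺)
open import Data.List.Relation.Unary.Any using (here)
open import Data.List.Relation.Unary.Unique.Propositional using (Unique)
open import Data.Product using (_×_; ∃; _,_; proj₁; proj₂)
open import Data.Sum using (_⊎_; inj₁; inj₂)
open import Data.Empty using (⊥-elim)
open import Relation.Nullary using (yes; no; ¬_)
open import Relation.Binary.PropositionalEquality
  using (_≡_; _≢_; refl; sym; trans; cong; cong₂; subst; subst₂)
open import Function.Bundles using (_⇔_; mk⇔)

private
  variable
    n : ℕ

lookup-⊕ : (X Y : Labeling n) (a : Fin n) → lookup (X ⊕ Y) a ≡ lookup X a + lookup Y a
lookup-⊕ X Y a = lookup-zipWith _+_ a X Y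

lookup-⊖ : (X Y : Labeling n) (a : Fin n) → lookup (X ⊖ Y) a ≡ lookup X a - lookup Y a
lookup-⊖ X Y a = lookup-zipWith _-_ a X Y

lookup-zeroL : (a : Fin n) → lookup (zeroL {n}) a ≡ + 0
lookup-zeroL a = lookup-replicate a (+ 0)

labeling-ext : {X Y : Labeling n} → (∀ a → lookup X a ≡ lookup Y a) → X ≡ Y
labeling-ext {X = X} {Y} eq =
  trans (sym (tabulate∘lookup X)) (trans (tabulate-cong eq) (tabulate∘lookup Y))

minus-plus : (x y : ℤ) → (x - y) + y ≡ x
minus-plus x y = trans (ℤP.+-assoc x (- y) y)
  (trans (cong (λ z → x + z) (ℤP.+-inverseˡ y)) (ℤP.+-identityʳ x))

0≢1 : + 0 ≢ + 1
0≢1 ()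

1≰0 : ¬ (+ 1 ≤ℤ + 0)
1≰0 (+≤+ ())

Standard-⊕ : (E : Edges n) (X Y : Labeling n) →
  Standard E X → Standard E Y → Standard E (X ⊕ Y)
Standard-⊕ E X Y (X≥0 , X↑) (Y≥0 , Y↑) =
  (λ a → subst (+ 0 ≤ℤ_) (sym (lookup-⊕ X Y a)) (ℤP.+-mono-≤ (X≥0 a) (Y≥0 a))) ,
  (λ a b ab → subst₂ _≤ℤ_ (sym (lookup-⊕ X Y a)) (sym (lookup-⊕ X Y b))
                (ℤP.+-mono-≤ (X↑ a b ab) (Y↑ a b ab)))

Standard-zeroL : (E : Edges n) → Standard E zeroL
Standard-zeroL E =
  (λ a → ℤP.≤-reflexive (sym (lookup-zeroL a))) ,
  (λ a b _ → ℤP.≤-reflexive (trans (lookup-zeroL a) (sym (lookup-zeroL b))))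

Standard-∑ : (E : Edges n) (Xs : List (Labeling n)) → All (Standard E) Xs → Standard E (∑ Xs)
Standard-∑ E []       []         = Standard-zeroL E
Standard-∑ E (X ∷ Xs) (sX ∷ sXs) = Standard-⊕ E X (∑ Xs) sX (Standard-∑ E Xs sXs)

Standard-cancel : (E : Edges n) (F S : Labeling n) →
  Standard E (F ⊖ S) → Standard E S → Standard E F
Standard-cancel E F S sFS sS = subst (Standard E) F⊖S⊕S≡F (Standard-⊕ E (F ⊖ S) S sFS sS)
  where
  F⊖S⊕S≡F : (F ⊖ S) ⊕ S ≡ F
  F⊖S⊕S≡F = labeling-ext λ a →
    trans (lookup-⊕ (F ⊖ S) S a)
      (trans (cong (_+ lookup S a) (lookup-⊖ F S a)) (minus-plus (lookup F a) (lookup S a)))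

decomposable⇒standard : (E : Edges n) (F : Labeling n) (v : Fin n) (K : List (Labeling n)) →
  StandardVDecomposition E F v K → Standard E F
decomposable⇒standard E F v K (components , rest , _) =
  Standard-cancel E F (∑ K) rest
    (Standard-∑ E K (All.map (λ c → proj₁ (proj₂ (proj₁ c))) components))

ZeroOne : Labeling n → Set
ZeroOne M = ∀ a → lookup M a ≡ + 0 ⊎ lookup M a ≡ + 1

VComponent : Edges n → Labeling n → Fin n → Labeling n → Set
VComponent E G v H = StandardComponent E G H × lookup H v ≡ + 1

-- A component lies below G, since G ⊖ H is standard.
component≤ : (E : Edges n) (G H : Labeling n) → StandardComponent E G H →
  (a : Fin n) → lookup H a ≤ℤ lookup G a
component≤ E G H (_ , _ , (G⊖H≥0 , _) , _) a =
  ℤP.0≤i-j⇒j≤i (subst (+ 0 ≤ℤ_) (lookup-⊖ G H a) (G⊖H≥0 a))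

∑-vanishes : (E : Edges n) (G : Labeling n) (v : Fin n) (Hs : List (Labeling n)) →
  All (VComponent E G v) Hs → (a : Fin n) → lookup G a ≡ + 0 → lookup (∑ Hs) a ≡ + 0
∑-vanishes E G v []       []             a _  = lookup-zeroL a
∑-vanishes E G v (H ∷ Hs) ((c , _) ∷ cs) a G0 =
  trans (lookup-⊕ H (∑ Hs) a) (cong₂ _+_ H0 (∑-vanishes E G v Hs cs a G0))
  where
  H0 : lookup H a ≡ + 0
  H0 with proj₁ c a
  ... | inj₁ h0 = h0
  ... | inj₂ h1 = ⊥-elim (1≰0 (subst₂ _≤ℤ_ h1 G0 (component≤ E G H c a)))

∑-bounded : (Hs : List (Labeling n)) → All ZeroOne Hs →
  (a : Fin n) → lookup (∑ Hs) a ≤ℤ + length Hs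
∑-bounded []       []          a = ℤP.≤-reflexive (lookup-zeroL a)
∑-bounded (H ∷ Hs) (H01 ∷ 01s) a =
  subst (_≤ℤ + length (H ∷ Hs)) (sym (lookup-⊕ H (∑ Hs) a))
    (ℤP.+-mono-≤ H≤1 (∑-bounded Hs 01s a))
  where
  H≤1 : lookup H a ≤ℤ + 1
  H≤1 with H01 a
  ... | inj₁ h0 = subst (_≤ℤ + 1) (sym h0) (+≤+ z≤n)
  ... | inj₂ h1 = ℤP.≤-reflexive h1

∑-at : (v : Fin n) (Hs : List (Labeling n)) →
  All (λ H → lookup H v ≡ + 1) Hs → lookup (∑ Hs) v ≡ + length Hs
∑-at v []       []        = lookup-zeroL v
∑-at v (H ∷ Hs) (Hv ∷ Hvs) =
  trans (lookup-⊕ H (∑ Hs) v) (cong₂ _+_ Hv (∑-at v Hs Hvs))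

maximal-positive : (G : Labeling n) (a : Fin n) →
  + 0 <ℤ lookup G a → lookup (maximalComponent G) a ≡ + 1
maximal-positive (x Vec.∷ G) Fin.zero G>0 with + 0 ℤP.<? x
... | yes _  = refl
... | no G≯0 = ⊥-elim (G≯0 G>0)
maximal-positive (_ Vec.∷ G) (Fin.suc a) G>0 = maximal-positive G a G>0

IsMultiple : ℕ → Labeling n → Labeling n → Set
IsMultiple e M X =
  ∀ a → (lookup M a ≡ + 0 → lookup X a ≡ + 0) × (lookup M a ≡ + 1 → lookup X a ≡ + e)

∑-replicate-multiple : (e : ℕ) (M : Labeling n) → IsMultiple e M (∑ (replicate e M))
∑-replicate-multiple zero    M a = (λ _ → lookup-zeroL a) , (λ _ → lookup-zeroL a)
∑-replicate-multiple (suc e) M a =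
  (λ M0 → trans (lookup-⊕ M _ a) (cong₂ _+_ M0 (proj₁ (∑-replicate-multiple e M a) M0))) ,
  (λ M1 → trans (lookup-⊕ M _ a) (cong₂ _+_ M1 (proj₂ (∑-replicate-multiple e M a) M1)))

peel : (E : Edges n) (F M X : Labeling n) (e : ℕ) →
  Standard E F → Standard E M → ZeroOne M →
  (∀ a → lookup M a ≡ + 0 → lookup F a ≡ + 0) →
  (∀ a → lookup M a ≡ + 1 → + e ≤ℤ lookup F a) →
  IsMultiple e M X → Standard E (F ⊖ X)
peel E F M X e (_ , F↑) (_ , M↑) M01 F-off F-on X≡eM = nonneg , monotone
  where
  off : ∀ a → lookup M a ≡ + 0 → lookup (F ⊖ X) a ≡ + 0
  off a M0 = trans (lookup-⊖ F X a) (cong₂ _-_ (F-off a M0) (proj₁ (X≡eM a) M0))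

  on : ∀ a → lookup M a ≡ + 1 → lookup (F ⊖ X) a ≡ lookup F a - + e
  on a M1 = trans (lookup-⊖ F X a) (cong (λ x → lookup F a - x) (proj₂ (X≡eM a) M1))

  nonneg : ∀ a → + 0 ≤ℤ lookup (F ⊖ X) a
  nonneg a with M01 a
  ... | inj₁ M0 = ℤP.≤-reflexive (sym (off a M0))
  ... | inj₂ M1 = subst (+ 0 ≤ℤ_) (sym (on a M1)) (ℤP.i≤j⇒0≤j-i (F-on a M1))

  -- An edge cannot leave the support of M, since M is standard.
  monotone : ∀ a b → (a , b) ∈ E → lookup (F ⊖ X) a ≤ℤ lookup (F ⊖ X) b
  monotone a b ab with M01 a | M01 b
  ... | inj₁ M0 | _       = subst (_≤ℤ lookup (F ⊖ X) b) (sym (off a M0)) (nonneg b)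
  ... | inj₂ M1 | inj₁ M0 =
    ⊥-elim (1≰0 (subst₂ _≤ℤ_ M1 M0 (M↑ a b ab)))
  ... | inj₂ M1 | inj₂ M1′ =
    subst₂ _≤ℤ_ (sym (on a M1)) (sym (on b M1′)) (ℤP.+-monoˡ-≤ (- + e) (F↑ a b ab))

module Backward {n : ℕ} (E : Edges n) (G : Labeling n) (v : Fin n)
  (v-minimal : MinimalPositive G v)
  (M-component : StandardComponent E G (maximalComponent G))
  (ℋ : List (Labeling n)) (ℋ-components : All (VComponent E G v) ℋ)
  (F-standard : Standard E (G ⊖ ∑ ℋ)) where

  M F : Labeling n
  M = maximalComponent G
  F = G ⊖ ∑ ℋ

  -- The number of copies of M in the decomposition: the label of v in F.
  d : ℕ
  d = ∣ lookup F v ∣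

  d≡Fv : + d ≡ lookup F v
  d≡Fv = ℤP.0≤i⇒+∣i∣≡i (proj₁ F-standard v)

  M-zero-one : ZeroOne M
  M-zero-one = proj₁ M-component

  M-standard : Standard E M
  M-standard = proj₁ (proj₂ M-component)

  M-at-v : lookup M v ≡ + 1
  M-at-v = maximal-positive G v (proj₁ v-minimal)

  -- Off the support of M, G vanishes, and hence so do ∑ℋ and F.
  F-off : ∀ a → lookup M a ≡ + 0 → lookup F a ≡ + 0
  F-off a M0 = trans (lookup-⊖ G (∑ ℋ) a) (cong₂ _-_ G0 (∑-vanishes E G v ℋ ℋ-components a G0))
    where
    G≯0 : ¬ (+ 0 <ℤ lookup G a)
    G≯0 G>0 = 0≢1 (trans (sym M0) (maximal-positive G a G>0))
    G0 : lookup G a ≡ + 0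
    G0 = ℤP.≤-antisym (ℤP.≮⇒≥ G≯0)
           (subst (_≤ℤ lookup G a) M0 (component≤ E G M M-component a))

  -- On the support of M, G is at least G(v) while ∑ℋ is at most |ℋ| = (∑ℋ)(v).
  F-on : ∀ a → lookup M a ≡ + 1 → + d ≤ℤ lookup F a
  F-on a M1 = begin
    + d                                   ≡⟨ d≡Fv ⟩
    lookup F v                            ≡⟨ lookup-⊖ G (∑ ℋ) v ⟩
    lookup G v - lookup (∑ ℋ) v           ≡⟨ cong (λ x → lookup G v - x) ∑ℋ-at-v ⟩
    lookup G v - + length ℋ               ≤⟨ ℤP.+-mono-≤ Gv≤Ga (ℤP.neg-mono-≤ ∑ℋ≤|ℋ|) ⟩
    lookup G a - lookup (∑ ℋ) a           ≡⟨ lookup-⊖ G (∑ ℋ) a ⟨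
    lookup F a                            ∎
    where
    open ℤP.≤-Reasoning
    ∑ℋ-at-v : lookup (∑ ℋ) v ≡ + length ℋ
    ∑ℋ-at-v = ∑-at v ℋ (All.map proj₂ ℋ-components)
    ∑ℋ≤|ℋ| : lookup (∑ ℋ) a ≤ℤ + length ℋ
    ∑ℋ≤|ℋ| = ∑-bounded ℋ (All.map (λ c → proj₁ (proj₁ c)) ℋ-components) a
    Gv≤Ga : lookup G v ≤ℤ lookup G a
    Gv≤Ga = proj₂ v-minimal a
      (ℤP.<-≤-trans (+<+ (s≤s z≤n)) (subst (_≤ℤ lookup G a) M1 (component≤ E G M M-component a)))

  peel-M : (e : ℕ) (X : Labeling n) → e ≤ d → IsMultiple e M X → Standard E (F ⊖ X)
  peel-M e X e≤d = peel E F M X e F-standard M-standard M-zero-one F-off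
    (λ a M1 → ℤP.≤-trans (+≤+ e≤d) (F-on a M1))

  M-component-of-F : 1 ≤ d → VComponent E F v M
  M-component-of-F 1≤d =
    (M-zero-one , M-standard , peel-M 1 M 1≤d (λ a → (λ M0 → M0) , (λ M1 → M1)) ,
     (v , λ Mv≡0 → 0≢1 (trans (sym Mv≡0) M-at-v))) ,
    M-at-v

  copies-are-components : (k : ℕ) → k ≤ d → All (VComponent E F v) (replicate k M)
  copies-are-components zero    _     = []
  copies-are-components (suc k) 1+k≤d =
    M-component-of-F (ℕP.≤-trans (s≤s z≤n) 1+k≤d) ∷
    copies-are-components k (ℕP.≤-trans (ℕP.n≤1+n k) 1+k≤d)

  decomposition : StandardVDecomposition E F v (replicate d M)
  decomposition =
    copies-are-components d ℕP.≤-refl ,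
    peel-M d (∑ (replicate d M)) ℕP.≤-refl (∑-replicate-multiple d M) ,
    trans (cong +_ (length-replicate d)) d≡Fv

proposition4p2 :
    (n : ℕ) (E : Edges n) → NoLoops E →
    (G : Labeling n) (v : Fin n) → MinimalPositive G v →
    (Hrest : List (Labeling n)) →
    All (λ H → StandardComponent E G H × lookup H v ≡ + 1) (maximalComponent G ∷ Hrest) →
    (∀ (H : Labeling n) → StandardComponent E G H → lookup H v ≡ + 1 → H ∈ (maximalComponent G ∷ Hrest)) →
    Unique (maximalComponent G ∷ Hrest) →
    (ℋ : List (Labeling n)) →
    All (λ H → H ∈ (maximalComponent G ∷ Hrest)) ℋ →
    (i : ℕ) → 1 ≤ i → i ≤ length (maximalComponent G ∷ Hrest) →
    (∃ (λ (K : List (Labeling n)) →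
        StandardVDecomposition E (G ⊖ ∑ ℋ) v K ×
        All (λ H → H ∈ take i (maximalComponent G ∷ Hrest)) K))
      ⇔ Standard E (G ⊖ ∑ ℋ)
proposition4p2 n E _ G v v-minimal Hrest listed-components _ _ ℋ ℋ-listed (suc j) _ _ =
  mk⇔ (λ (K , K-decomposes , _) → decomposable⇒standard E (G ⊖ ∑ ℋ) v K K-decomposes)
      (λ F-standard →
        let open Backward E G v v-minimal M-component ℋ ℋ-components F-standard
        -- every copy of M = H₁ lies among H₁, …, Hᵢ since i ≥ 1
        in replicate d M , decomposition , replicate⁺ d (here refl))
  where
  M-component : StandardComponent E G (maximalComponent G)
  M-component = proj₁ (All.head listed-components)

  ℋ-components : All (VComponent E G v) ℋ
  ℋ-components = All.map (All.lookup listed-components) ℋ-listed
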